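{- Let $\Omega$ be a finite set of size $n$ and $1\le r\le n$. Let $\{\mathcal{H}_1,\dots,\mathcal{H}_s\}$ be the set of all minimal domination completions of $\mathcal{U}_{r,\Omega}$ (the minimal elements of $(\mathrm{Dom}(r,\Omega),\leqslant)$). Then $\mathcal{U}_{r,\Omega}=\mathcal{H}_1\sqcap\cdots\sqcap\mathcal{H}_s$.
   Context: Graphs are finite, simple, undirected; $\mathcal{D}(G)$ is the family of inclusion-minimal dominating sets of $G$ (a dominating set is $D\subseteq V(G)$ such that every vertex outside $D$ has a neighbour in $D$). A hypergraph on $\Omega$ is a nonempty family of nonempty subsets of $\Omega$, none a proper subset of another; it has ground set $\Omega$ if the union of its members is $\Omega$. A domination hypergraph is one of the form $\mathcal{D}(G)$ for a graph $G$. $\mathcal{U}_{r,\Omega}=\{A\subseteq\Omega:|A|=r\}$. For hypergraphs $\mathcal{H}_1,\mathcal{H}_2$ on $\Omega$, $\mathcal{H}_1\leqslant\mathcal{H}_2$ means: for every $A_1\in\mathcal{H}_1$ there is $A_2\in\mathcal{H}_2$ with $A_2\subseteq A_1$ (a partial order). $\mathrm{Dom}(r,\Omega)$ is the set of domination hypergraphs $\mathcal{H}$ with ground set $\Omega$ with $\mathcal{U}_{r,\Omega}\leqslant\mathcal{H}$. For hypergraphs $\mathcal{H}_1,\dots,\mathcal{H}_\ell$ on $\Omega$, $\mathcal{H}_1\sqcap\cdots\sqcap\mathcal{H}_\ell$ is the family of inclusion-minimal sets among $\{A_1\cup\cdots\cup A_\ell: A_i\in\mathcal{H}_i\}$. 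-}

module Defs where

open import Data.Nat using (ℕ; _≟_)
open import Relation.Nullary using (yes; no)
open import Data.Bool using (Bool; true; false)
open import Data.Fin using (Fin)
open import Data.Fin.Subset using (Subset; _∈_; _∉_; _⊆_; _⊂_; ∣_∣)
open import Data.Product using (Σ; ∃; _×_; _,_)
open import Relation.Nullary using (¬_)
open import Relation.Binary.PropositionalEquality using (_≡_)
open import Function.Bundles using (_⇔_)

-- The ground set Ω is Fin n.  A family of subsets of Ω is given by a
-- (decidable) membership predicate on subsets.
Family : ℕ → Set
Family n = Subset n → Bool

_∈ᶠ_ : ∀ {n} → Subset n → Family n → Set
A ∈ᶠ H = H A ≡ true

_≐_ : ∀ {n} → Family n → Family n → Set
H₁ ≐ H₂ = ∀ A → H₁ A ≡ H₂ A

IsHypergraph : ∀ {n} → Family n → Set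
IsHypergraph {n} H =
  (∃ λ A → A ∈ᶠ H)
  × (∀ A → A ∈ᶠ H → ∃ λ x → x ∈ A)
  × (∀ A B → A ∈ᶠ H → B ∈ᶠ H → ¬ (A ⊂ B))

HasGroundSet : ∀ {n} → Family n → Set
HasGroundSet {n} H = ∀ (x : Fin n) → ∃ λ A → A ∈ᶠ H × x ∈ A

record Graph (n : ℕ) : Set where
  field
    adj   : Fin n → Fin n → Bool
    sym   : ∀ u v → adj u v ≡ adj v u
    irrefl : ∀ u → adj u u ≡ false
open Graph public

Dominating : ∀ {n} → Graph n → Subset n → Set
Dominating G D = ∀ v → v ∉ D → ∃ λ u → u ∈ D × adj G u v ≡ true

MinimalDominating : ∀ {n} → Graph n → Subset n → Set
MinimalDominating G D = Dominating G D × (∀ D' → D' ⊂ D → ¬ Dominating G D')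

IsDominationHypergraph : ∀ {n} → Family n → Set
IsDominationHypergraph {n} H =
  IsHypergraph H × (∃ λ (G : Graph n) → ∀ A → (A ∈ᶠ H) ⇔ MinimalDominating G A)

U : ∀ {n} → ℕ → Family n
U r A with ∣ A ∣ ≟ r
... | yes _ = true
... | no _ = false

_⩽_ : ∀ {n} → Family n → Family n → Set
H₁ ⩽ H₂ = ∀ A₁ → A₁ ∈ᶠ H₁ → ∃ λ A₂ → A₂ ∈ᶠ H₂ × A₂ ⊆ A₁

InDom : ∀ {n} → ℕ → Family n → Set
InDom r H = IsDominationHypergraph H × HasGroundSet H × (U r ⩽ H)

IsMinimalCompletion : ∀ {n} → ℕ → Family n → Set
IsMinimalCompletion r H = InDom r H × (∀ H' → InDom r H' → H' ⩽ H → H' ≐ H)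

-- Y is a union A_1 ∪ ... of one member A_H ∈ H chosen from each family H
-- satisfying P
IsUnionOfChoice : ∀ {n} → (Family n → Set) → Subset n → Set
IsUnionOfChoice {n} P Y =
  Σ ((H : Family n) → P H → Subset n) λ c →
    (∀ H (p : P H) → c H p ∈ᶠ H)
    × (∀ x → x ∈ Y ⇔ (∃ λ H → Σ (P H) λ p → x ∈ c H p))

-- membership in the meet ⨅ of all families satisfying P:
-- inclusion-minimal sets among such unions
InMeet : ∀ {n} → (Family n → Set) → Subset n → Set
InMeet P A = IsUnionOfChoice P A × (∀ B → IsUnionOfChoice P B → ¬ (B ⊂ A))

module Submission where

-- For |Y| < r ≤ n pick v ∉ Y and let G be the complete graph with the edges between v and Y
-- deleted. Every r-set dominates G while Y does not, and every vertex lies in a minimal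
-- dominating set, so 𝒟(G) ∈ Dom(r, Ω). Below it there is a minimal completion H, because the
-- number of sets containing a member strictly decreases down the order; like 𝒟(G), H has no
-- member inside Y. Hence a union of one member chosen from each minimal completion has at
-- least r elements, while every r-set A is such a union: choose inside A in each completion,
-- and x ∈ A is then covered by the completion avoiding A - x.

open import Data.Bool using (Bool; true; false; _∨_; if_then_else_)
open import Data.Bool.Properties using (∨-comm; ∨-idem; ⇔→≡) renaming (_≟_ to _≟ᵇ_)
open import Data.Empty using (⊥-elim)
open import Data.Fin using (Fin)
open import Data.Fin.Properties using (any?; all?; ¬∀⟶∃¬) renaming (_≟_ to _≟ᶠ_)
open import Data.Fin.Subset
  using (Subset; _∈_; _∉_; _⊆_; _⊂_; ∣_∣; ⊥; ⊤; ⁅_⁆; _∪_; _-_; inside; outside)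
open import Data.Fin.Subset.Properties
  using ( _∈?_; _⊆?_; _⊂?_; anySubset?; nonempty?; Empty-unique; ∉⊥; ∈⊤; ∣⊥∣≡0; ∣⊤∣≡n
        ; ∣⁅x⁆∣≡1; x∈⁅x⁆; x∈⁅y⁆⇒x≡y; x∉⁅y⁆⇒x≢y; x∈p∪q⁺; x∈p∪q⁻; ⊆-refl; ⊆-trans
        ; ⊆-antisym; ⊆-⊂-trans; out⊆; in⊆in; p⊆q⇒∣p∣≤∣q∣; p⊂q⇒∣p∣<∣q∣
        ; x∈p∧x≢y⇒x∈p-y; x∈p⇒∣p-x∣<∣p∣ )
open import Data.Fin.Subset.Induction using (⊂-wellFounded)
open import Data.Nat using (ℕ; zero; suc; _≤_; _<_; _+_; z≤n; s≤s) renaming (_≟_ to _≟ⁿ_)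
open import Data.Nat.Induction using (<-wellFounded)
open import Data.Nat.Properties
  using (≤-refl; ≤-reflexive; ≤-antisym; <-irrefl; <-≤-trans; ≤-<-trans; <⇒≤; <⇒≱; ≮⇒≥
        ; +-mono-≤; +-mono-<-≤; +-mono-≤-<)
open import Data.Product using (∃; Σ; _×_; _,_; proj₁; proj₂)
open import Data.Sum using (inj₁; inj₂)
open import Data.Vec using (Vec; []; _∷_; lookup; tabulate)
open import Data.Vec.Properties using (lookup∘tabulate)
open import Function using (_∘_; _on_; case_of_)
open import Function.Bundles using (_⇔_; mk⇔; Equivalence)
open import Induction.WellFounded using (WellFounded; Acc; acc; module Subrelation)
open import Relation.Binary.Construct.Closure.ReflexiveTransitive using (Star; ε; _◅_; _◅◅_)
import Relation.Binary.Construct.On as On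
open import Relation.Binary.PropositionalEquality
  using (_≡_; _≢_; refl; trans; cong; cong₂; subst; ≢-sym; module ≡-Reasoning)
import Relation.Binary.PropositionalEquality as ≡
open import Relation.Nullary using (¬_; Dec; yes; no; does; ¬?)
open import Relation.Nullary.Decidable
  using (dec-true; dec-false; does-⇔; decidable-stable; map′; _×-dec_; _→-dec_)

open import Defs

dec-witness : ∀ {A : Set} (a? : Dec A) → does a? ≡ true → A
dec-witness (yes a) _ = a
dec-witness (no _) ()

allSubset? : ∀ {n} {P : Subset n → Set} → (∀ p → Dec (P p)) → Dec (∀ p → P p)
allSubset? P? with anySubset? (¬? ∘ P?)
... | yes (p , ¬Pp) = no λ ∀P → ¬Pp (∀P p)
... | no ∄¬P = yes λ p → decidable-stable (P? p) λ ¬Pp → ∄¬P (p , ¬Pp)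

Searchable : Set → Set₁
Searchable A = ∀ {P : A → Set} → (∀ x → Dec (P x)) → Dec (∃ P)

Vec-searchable : ∀ {A} → Searchable A → ∀ m → Searchable (Vec A m)
Vec-searchable search zero P? = map′ ([] ,_) (λ { ([] , p) → p }) (P? [])
Vec-searchable search (suc m) P? =
  map′ (λ (x , xs , p) → x ∷ xs , p) (λ { (x ∷ xs , p) → x , xs , p })
       (search λ x → Vec-searchable search m (P? ∘ (x ∷_)))

module _ {A : Set} {_⊏_ : A → A → Set} (wf : WellFounded _⊏_) (Q : A → Set)
         (below? : ∀ x → Dec (∃ λ y → Q y × y ⊏ x)) where

  minimal-below : ∀ x → Q x → ∃ λ y → Q y × Star _⊏_ y x × ∀ z → Q z → ¬ z ⊏ y
  minimal-below x = go (wf x)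
    where
    go : ∀ {x} → Acc _⊏_ x → Q x → ∃ λ y → Q y × Star _⊏_ y x × ∀ z → Q z → ¬ z ⊏ y
    go {x} (acc rs) Qx with below? x
    ... | no ∄ = x , Qx , ε , λ z Qz z⊏x → ∄ (z , Qz , z⊏x)
    ... | yes (y , Qy , y⊏x) with go (rs y⊏x) Qy
    ...   | z , Qz , z⊏*y , minimal = z , Qz , z⊏*y ◅◅ y⊏x ◅ ε , minimal

module _ {n : ℕ} where

  ⊈⇒∃∉ : {p q : Subset n} → ¬ p ⊆ q → ∃ λ x → x ∈ p × x ∉ q
  ⊈⇒∃∉ {p} {q} p⊈q with any? (λ x → (x ∈? p) ×-dec ¬? (x ∈? q))
  ... | yes w = w
  ... | no ∄ = ⊥-elim (p⊈q λ {x} x∈p → decidable-stable (x ∈? q) λ x∉q → ∄ (x , x∈p , x∉q))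

  ⊆∧≢⇒⊂ : {p q : Subset n} → p ⊆ q → p ≢ q → p ⊂ q
  ⊆∧≢⇒⊂ p⊆q p≢q = p⊆q , ⊈⇒∃∉ (p≢q ∘ ⊆-antisym p⊆q)

  ⊆∪⁅x⁆⇒⊆ : {p q : Subset n} {x : Fin n} → p ⊆ q ∪ ⁅ x ⁆ → x ∉ p → p ⊆ q
  ⊆∪⁅x⁆⇒⊆ {p} {q} {x} p⊆q∪x x∉p {y} y∈p with x∈p∪q⁻ q ⁅ x ⁆ (p⊆q∪x y∈p)
  ... | inj₁ y∈q = y∈q
  ... | inj₂ y∈⁅x⁆ = ⊥-elim (x∉p (subst (_∈ p) (x∈⁅y⁆⇒x≡y x y∈⁅x⁆) y∈p))

  ∉∪⇒∉ˡ : {p q : Subset n} {x : Fin n} → x ∉ p ∪ q → x ∉ p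
  ∉∪⇒∉ˡ x∉p∪q x∈p = x∉p∪q (x∈p∪q⁺ (inj₁ x∈p))

  ∉∪⁅y⁆⇒≢ : {p : Subset n} {x y : Fin n} → x ∉ p ∪ ⁅ y ⁆ → x ≢ y
  ∉∪⁅y⁆⇒≢ x∉p∪y refl = x∉p∪y (x∈p∪q⁺ (inj₂ (x∈⁅x⁆ _)))

  ∣p∣<n⇒∃∉ : {p : Subset n} → ∣ p ∣ < n → ∃ λ x → x ∉ p
  ∣p∣<n⇒∃∉ {p} ∣p∣<n = ¬∀⟶∃¬ n (_∈ p) (_∈? p) λ ∀∈p →
    <⇒≱ ∣p∣<n (subst (_≤ ∣ p ∣) (∣⊤∣≡n n) (p⊆q⇒∣p∣≤∣q∣ {p = ⊤} λ {x} _ → ∀∈p x))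

⊆-of-size : ∀ {n} (A : Subset n) k → k ≤ ∣ A ∣ → ∃ λ B → B ⊆ A × ∣ B ∣ ≡ k
⊆-of-size [] zero _ = [] , ⊆-refl , refl
⊆-of-size {suc n} (inside ∷ A) zero _ = ⊥ , ⊥-elim ∘ ∉⊥ , ∣⊥∣≡0 (suc n)
⊆-of-size (inside ∷ A) (suc k) (s≤s k≤∣A∣) =
  let (B , B⊆A , ∣B∣≡k) = ⊆-of-size A k k≤∣A∣ in inside ∷ B , in⊆in B⊆A , cong suc ∣B∣≡k
⊆-of-size (outside ∷ A) k k≤∣A∣ =
  let (B , B⊆A , ∣B∣≡k) = ⊆-of-size A k k≤∣A∣ in outside ∷ B , out⊆ B⊆A , ∣B∣≡k

Star⊂⇒⊆ : ∀ {n} {p q : Subset n} → Star _⊂_ p q → p ⊆ q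
Star⊂⇒⊆ ε = ⊆-refl
Star⊂⇒⊆ (p⊂q ◅ q⊂*r) = ⊆-trans (proj₁ p⊂q) (Star⊂⇒⊆ q⊂*r)

count : ∀ {n} {P : Subset n → Set} → (∀ p → Dec (P p)) → ℕ
count {zero} P? = if does (P? []) then 1 else 0
count {suc n} P? = count (P? ∘ (outside ∷_)) + count (P? ∘ (inside ∷_))

count-mono : ∀ {n} {P Q : Subset n → Set} (P? : ∀ p → Dec (P p)) (Q? : ∀ p → Dec (Q p)) →
             (∀ p → P p → Q p) → count P? ≤ count Q?
count-mono {zero} P? Q? P⇒Q with P? [] | Q? []
... | yes _  | yes _  = ≤-refl
... | no _   | yes _  = z≤n
... | no _   | no _   = ≤-refl
... | yes Pp | no ¬Qp = ⊥-elim (¬Qp (P⇒Q [] Pp))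
count-mono {suc n} P? Q? P⇒Q =
  +-mono-≤ (count-mono _ _ (P⇒Q ∘ (outside ∷_))) (count-mono _ _ (P⇒Q ∘ (inside ∷_)))

count-strictMono : ∀ {n} {P Q : Subset n → Set} (P? : ∀ p → Dec (P p)) (Q? : ∀ p → Dec (Q p)) →
                   (∀ p → P p → Q p) → ∀ p → Q p → ¬ P p → count P? < count Q?
count-strictMono {zero} P? Q? P⇒Q [] Qp ¬Pp with P? [] | Q? []
... | yes Pp | _      = ⊥-elim (¬Pp Pp)
... | no _   | yes _  = s≤s z≤n
... | no _   | no ¬Qp = ⊥-elim (¬Qp Qp)
count-strictMono {suc n} P? Q? P⇒Q (outside ∷ p) Qp ¬Pp =
  +-mono-<-≤ (count-strictMono _ _ (P⇒Q ∘ (outside ∷_)) p Qp ¬Pp)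
             (count-mono _ _ (P⇒Q ∘ (inside ∷_)))
count-strictMono {suc n} P? Q? P⇒Q (inside ∷ p) Qp ¬Pp =
  +-mono-≤-< (count-mono _ _ (P⇒Q ∘ (outside ∷_)))
             (count-strictMono _ _ (P⇒Q ∘ (inside ∷_)) p Qp ¬Pp)

Antichain : ∀ {n} → Family n → Set
Antichain H = ∀ A B → A ∈ᶠ H → B ∈ᶠ H → ¬ A ⊂ B

-- A record rather than a function type, so that both graphs can be inferred from a proof.
record _≈ᴳ_ {n} (G G' : Graph n) : Set where
  constructor same-adj
  field adj-≡ : ∀ u w → adj G u w ≡ adj G' u w
open _≈ᴳ_

≈ᴳ-sym : ∀ {n} {G G' : Graph n} → G ≈ᴳ G' → G' ≈ᴳ G
≈ᴳ-sym G≈G' = same-adj λ u w → ≡.sym (adj-≡ G≈G' u w)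

decGraph : ∀ {n} {R : Fin n → Fin n → Set} → (∀ u w → Dec (R u w)) →
           (∀ {u w} → R u w → R w u) → (∀ {u} → ¬ R u u) → Graph n
decGraph R? R-sym R-irrefl = record
  { adj    = λ u w → does (R? u w)
  ; sym    = λ u w → does-⇔ (mk⇔ R-sym R-sym) (R? u w) (R? w u)
  ; irrefl = λ u → dec-false (R? u u) R-irrefl
  }

module _ {n : ℕ} (G : Graph n) where

  dominating? : ∀ D → Dec (Dominating G D)
  dominating? D = all? λ w → ¬? (w ∈? D) →-dec any? λ u → (u ∈? D) ×-dec (adj G u w ≟ᵇ true)

  minimalDominating? : ∀ D → Dec (MinimalDominating G D)
  minimalDominating? D = dominating? D ×-dec allSubset? λ D' → D' ⊂? D →-dec ¬? (dominating? D')

  dominating-mono : ∀ {D E} → Dominating G D → D ⊆ E → Dominating G E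
  dominating-mono dom D⊆E w w∉E =
    let (u , u∈D , uw) = dom w (w∉E ∘ D⊆E) in u , D⊆E u∈D , uw

  ⊥-not-dominating : Fin n → ¬ Dominating G ⊥
  ⊥-not-dominating w dom = ∉⊥ (proj₁ (proj₂ (dom w ∉⊥)))

  minimalDominating-⊆ : ∀ {D} → Dominating G D → ∃ λ M → M ⊆ D × MinimalDominating G M
  minimalDominating-⊆ {D} dom =
    let (M , domM , M⊂*D , minimal) = minimal-below ⊂-wellFounded (Dominating G) below? D dom
    in M , Star⊂⇒⊆ M⊂*D , domM , λ D' D'⊂M domD' → minimal D' domD' D'⊂M
    where
    below? : ∀ D → Dec (∃ λ D' → Dominating G D' × D' ⊂ D)
    below? D = anySubset? λ D' → dominating? D' ×-dec D' ⊂? D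

  𝒟 : Family n
  𝒟 D = does (minimalDominating? D)

  minimalDominating⇒∈𝒟 : ∀ {D} → MinimalDominating G D → D ∈ᶠ 𝒟
  minimalDominating⇒∈𝒟 {D} = dec-true (minimalDominating? D)

  ∈𝒟⇒minimalDominating : ∀ {D} → D ∈ᶠ 𝒟 → MinimalDominating G D
  ∈𝒟⇒minimalDominating {D} = dec-witness (minimalDominating? D)

  critical⇒∈𝒟 : ∀ {E x} → Dominating G (E ∪ ⁅ x ⁆) → ¬ Dominating G E →
                ∃ λ A → A ∈ᶠ 𝒟 × x ∈ A
  critical⇒∈𝒟 {E} {x} dom ¬domE with minimalDominating-⊆ dom
  ... | M , M⊆E∪x , minM with x ∈? M
  ...   | yes x∈M = M , minimalDominating⇒∈𝒟 minM , x∈M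
  ...   | no x∉M = ⊥-elim (¬domE (dominating-mono (proj₁ minM) (⊆∪⁅x⁆⇒⊆ M⊆E∪x x∉M)))

  large-sets-dominate : (N : Fin n → Subset n) →
                        (∀ {u w} → u ≢ w → u ∉ N w → adj G u w ≡ true) →
                        ∀ {S} → (∀ w → ∣ N w ∣ < ∣ S ∣) → Dominating G S
  large-sets-dominate N adjacent {S} small w w∉S =
    let (u , u∈S , u∉N) = ⊈⇒∃∉ {q = N w} λ S⊆N → <⇒≱ (small w) (p⊆q⇒∣p∣≤∣q∣ S⊆N)
    in u , u∈S , adjacent (λ u≡w → w∉S (subst (_∈ S) u≡w u∈S)) u∉N

  𝒟-antichain : Antichain 𝒟
  𝒟-antichain A B A∈𝒟 B∈𝒟 A⊂B =
    proj₂ (∈𝒟⇒minimalDominating B∈𝒟) A A⊂B (proj₁ (∈𝒟⇒minimalDominating A∈𝒟))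

  𝒟-isDominationHypergraph : Fin n → IsDominationHypergraph 𝒟
  𝒟-isDominationHypergraph x =
    (inhabited , members-nonempty , 𝒟-antichain) ,
    G , λ A → mk⇔ ∈𝒟⇒minimalDominating minimalDominating⇒∈𝒟
    where
    inhabited : ∃ λ A → A ∈ᶠ 𝒟
    inhabited =
      let (M , _ , minM) = minimalDominating-⊆ {⊤} λ w w∉⊤ → ⊥-elim (w∉⊤ ∈⊤)
      in M , minimalDominating⇒∈𝒟 minM
    members-nonempty : ∀ A → A ∈ᶠ 𝒟 → ∃ λ y → y ∈ A
    members-nonempty A A∈𝒟 with nonempty? A
    ... | yes y∈A = y∈A
    ... | no empty = ⊥-elim (⊥-not-dominating x
            (subst (Dominating G) (Empty-unique empty) (proj₁ (∈𝒟⇒minimalDominating A∈𝒟))))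

  ≐𝒟 : ∀ {H : Family n} → (∀ A → A ∈ᶠ H ⇔ MinimalDominating G A) → H ≐ 𝒟
  ≐𝒟 H⇔ A = ⇔→≡ (mk⇔ (minimalDominating⇒∈𝒟 ∘ Equivalence.to (H⇔ A))
                      (Equivalence.from (H⇔ A) ∘ ∈𝒟⇒minimalDominating))

dominating-cong : ∀ {n} {G G' : Graph n} → G ≈ᴳ G' → ∀ {D} → Dominating G D → Dominating G' D
dominating-cong G≈G' dom w w∉D =
  let (u , u∈D , uw) = dom w w∉D in u , u∈D , trans (≡.sym (adj-≡ G≈G' u w)) uw

𝒟-cong : ∀ {n} {G G' : Graph n} → G ≈ᴳ G' → 𝒟 G ≐ 𝒟 G'
𝒟-cong {G = G} {G'} G≈G' D = does-⇔ (mk⇔ (cong-minimal G≈G') (cong-minimal (≈ᴳ-sym G≈G')))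
                                     (minimalDominating? G D) (minimalDominating? G' D)
  where
  cong-minimal : ∀ {H H'} → H ≈ᴳ H' → MinimalDominating H D → MinimalDominating H' D
  cong-minimal H≈H' (dom , minimal) =
    dominating-cong H≈H' dom , λ D' D'⊂D dom' → minimal D' D'⊂D (dominating-cong (≈ᴳ-sym H≈H') dom')

U-size : ∀ {n r} {A : Subset n} → A ∈ᶠ U r → ∣ A ∣ ≡ r
U-size {r = r} {A} A∈U with ∣ A ∣ ≟ⁿ r
U-size _  | yes ∣A∣≡r = ∣A∣≡r
U-size () | no _

size⇒∈U : ∀ {n r} {A : Subset n} → ∣ A ∣ ≡ r → A ∈ᶠ U r
size⇒∈U {r = r} {A} ∣A∣≡r with ∣ A ∣ ≟ⁿ r
... | yes _ = refl
... | no ∣A∣≢r = ⊥-elim (∣A∣≢r ∣A∣≡r)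

Avoids : ∀ {n} → Family n → Subset n → Set
Avoids H Y = ∀ M → M ∈ᶠ H → ¬ M ⊆ Y

module _ {n : ℕ} where

  ⩽-refl : {H : Family n} → H ⩽ H
  ⩽-refl A A∈H = A , A∈H , ⊆-refl

  ⩽-trans : {H₁ H₂ H₃ : Family n} → H₁ ⩽ H₂ → H₂ ⩽ H₃ → H₁ ⩽ H₃
  ⩽-trans H₁⩽H₂ H₂⩽H₃ A A∈H₁ =
    let (B , B∈H₂ , B⊆A) = H₁⩽H₂ A A∈H₁
        (C , C∈H₃ , C⊆B) = H₂⩽H₃ B B∈H₂
    in C , C∈H₃ , ⊆-trans C⊆B B⊆A

  ⩽-respˡ-≐ : {H₁ H₂ H₃ : Family n} → H₁ ≐ H₂ → H₁ ⩽ H₃ → H₂ ⩽ H₃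
  ⩽-respˡ-≐ H₁≐H₂ H₁⩽H₃ A A∈H₂ = H₁⩽H₃ A (trans (H₁≐H₂ A) A∈H₂)

  ⩽-respʳ-≐ : {H₁ H₂ H₃ : Family n} → H₂ ≐ H₃ → H₁ ⩽ H₂ → H₁ ⩽ H₃
  ⩽-respʳ-≐ H₂≐H₃ H₁⩽H₂ A A∈H₁ =
    let (B , B∈H₂ , B⊆A) = H₁⩽H₂ A A∈H₁ in B , trans (≡.sym (H₂≐H₃ B)) B∈H₂ , B⊆A

  _⩽?_ : (H₁ H₂ : Family n) → Dec (H₁ ⩽ H₂)
  H₁ ⩽? H₂ = allSubset? λ A → H₁ A ≟ᵇ true →-dec anySubset? λ B → (H₂ B ≟ᵇ true) ×-dec (B ⊆? A)

  Completion : ℕ → Family n → Set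
  Completion r H = HasGroundSet H × U r ⩽ H

  completion? : ∀ r H → Dec (Completion r H)
  completion? r H = all? (λ x → anySubset? λ A → (H A ≟ᵇ true) ×-dec (x ∈? A)) ×-dec (U r ⩽? H)

  completion-resp-≐ : ∀ {r} {H₁ H₂ : Family n} → H₁ ≐ H₂ → Completion r H₁ → Completion r H₂
  completion-resp-≐ H₁≐H₂ (ground , U⩽H₁) =
    (λ x → let (A , A∈H₁ , x∈A) = ground x in A , trans (≡.sym (H₁≐H₂ A)) A∈H₁ , x∈A) ,
    ⩽-respʳ-≐ H₁≐H₂ U⩽H₁

  _⊏_ : Family n → Family n → Set
  H' ⊏ H = H' ⩽ H × ∃ λ A → H' A ≢ H A

  _⊏?_ : ∀ H' H → Dec (H' ⊏ H)
  H' ⊏? H = (H' ⩽? H) ×-dec anySubset? λ A → ¬? (H' A ≟ᵇ H A)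

  member≢nonmember : {H : Family n} {A B : Subset n} → A ∈ᶠ H → H B ≡ false → A ≢ B
  member≢nonmember A∈H B∉H refl = case trans (≡.sym A∈H) B∉H of λ ()

  Up : Family n → Subset n → Set
  Up H A = ∃ λ M → M ∈ᶠ H × M ⊆ A

  upsetSize : Family n → ℕ
  upsetSize H = count λ A → anySubset? λ M → (H M ≟ᵇ true) ×-dec (M ⊆? A)

  -- At a set where H' and H differ, one of them has a member lying above no member of H'.
  ⊏-separating : {H' H : Family n} → Antichain H' → Antichain H → H' ⊏ H →
                 ∃ λ B → Up H B × ¬ Up H' B
  ⊏-separating {H'} {H} anti' anti (H'⩽H , A , H'A≢HA) with H' A in A∈H' | H A in A∈H
  ... | true  | true  = ⊥-elim (H'A≢HA refl)
  ... | false | false = ⊥-elim (H'A≢HA refl)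
  ... | true  | false =
    let (M , M∈H , M⊆A) = H'⩽H A A∈H'
        M⊂A = ⊆∧≢⇒⊂ M⊆A (member≢nonmember {H = H} M∈H A∈H)
    in M , (M , M∈H , ⊆-refl) , λ (M' , M'∈H' , M'⊆M) → anti' M' A M'∈H' A∈H' (⊆-⊂-trans M'⊆M M⊂A)
  ... | false | true = A , (A , A∈H , ⊆-refl) , λ (M' , M'∈H' , M'⊆A) →
    let (M , M∈H , M⊆M') = H'⩽H M' M'∈H'
        M'⊂A = ⊆∧≢⇒⊂ M'⊆A (member≢nonmember {H = H'} M'∈H' A∈H')
    in anti M A M∈H A∈H (⊆-⊂-trans M⊆M' M'⊂A)

  Up-mono : {H' H : Family n} → H' ⩽ H → ∀ A → Up H' A → Up H A
  Up-mono H'⩽H A (M' , M'∈H' , M'⊆A) =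
    let (M , M∈H , M⊆M') = H'⩽H M' M'∈H' in M , M∈H , ⊆-trans M⊆M' M'⊆A

  upsetSize-strictMono : {H' H : Family n} → Antichain H' → Antichain H → H' ⊏ H →
                         upsetSize H' < upsetSize H
  upsetSize-strictMono anti' anti H'⊏H =
    let (B , B∈UpH , B∉UpH') = ⊏-separating anti' anti H'⊏H
    in count-strictMono _ _ (Up-mono (proj₁ H'⊏H)) B B∈UpH B∉UpH'

-- Graphs on Fin n are not searchable, but their adjacency matrices are.
Code : ℕ → Set
Code n = Vec (Subset n) n

module _ {n : ℕ} where

  codeEdge : Code n → Fin n → Fin n → Bool
  codeEdge c u w = lookup (lookup c u) w ∨ lookup (lookup c w) u

  codeEdge? : (c : Code n) → ∀ u w → Dec (u ≢ w × codeEdge c u w ≡ true)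
  codeEdge? c u w = ¬? (u ≟ᶠ w) ×-dec (codeEdge c u w ≟ᵇ true)

  toGraph : Code n → Graph n
  toGraph c = decGraph (codeEdge? c)
    (λ {u} {w} (u≢w , uw) → ≢-sym u≢w , trans (∨-comm (lookup (lookup c w) u) (lookup (lookup c u) w)) uw)
    (λ (u≢u , _) → u≢u refl)

  encode : Graph n → Code n
  encode G = tabulate λ u → tabulate λ w → adj G u w

  toGraph-encode : (G : Graph n) → toGraph (encode G) ≈ᴳ G
  toGraph-encode G = same-adj λ u w →
    ⇔→≡ (mk⇔ (λ e → trans (≡.sym (codeEdge-encode u w)) (proj₂ (dec-witness (codeEdge? (encode G) u w) e)))
             (λ uw → dec-true (codeEdge? (encode G) u w) (u≢w uw , trans (codeEdge-encode u w) uw)))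
    where
    entry : ∀ u w → lookup (lookup (encode G) u) w ≡ adj G u w
    entry u w = trans (cong (λ row → lookup row w) (lookup∘tabulate _ u)) (lookup∘tabulate _ w)
    codeEdge-encode : ∀ u w → codeEdge (encode G) u w ≡ adj G u w
    codeEdge-encode u w = begin
      lookup (lookup (encode G) u) w ∨ lookup (lookup (encode G) w) u ≡⟨ cong₂ _∨_ (entry u w) (entry w u) ⟩
      adj G u w ∨ adj G w u                                           ≡⟨ cong (adj G u w ∨_) (Graph.sym G w u) ⟩
      adj G u w ∨ adj G u w                                           ≡⟨ ∨-idem _ ⟩
      adj G u w                                                       ∎
      where open ≡-Reasoning
    u≢w : ∀ {u w} → adj G u w ≡ true → u ≢ w
    u≢w {u} uw refl = case trans (≡.sym uw) (Graph.irrefl G u) of λ ()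

  𝒟ᶜ : Code n → Family n
  𝒟ᶜ c = 𝒟 (toGraph c)

  inDom⇒≐𝒟ᶜ : ∀ {r} {H : Family n} → InDom r H → ∃ λ c → H ≐ 𝒟ᶜ c
  inDom⇒≐𝒟ᶜ ((_ , G , H⇔) , _) =
    encode G , λ A → trans (≐𝒟 G H⇔ A) (𝒟-cong (≈ᴳ-sym (toGraph-encode G)) A)

  ⊏ᶜ-wellFounded : WellFounded (_⊏_ on 𝒟ᶜ)
  ⊏ᶜ-wellFounded = Subrelation.wellFounded (λ {c'} {c} → decreasing {c'} {c})
                                           (On.wellFounded (upsetSize ∘ 𝒟ᶜ) <-wellFounded)
    where
    -- Codes are passed explicitly: inferring c from 𝒟ᶜ c makes Agda unfold the decision procedures.
    decreasing : ∀ {c' c} → 𝒟ᶜ c' ⊏ 𝒟ᶜ c → upsetSize (𝒟ᶜ c') < upsetSize (𝒟ᶜ c)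
    decreasing {c'} {c} = upsetSize-strictMono {H' = 𝒟ᶜ c'} {H = 𝒟ᶜ c}
                            (𝒟-antichain (toGraph c')) (𝒟-antichain (toGraph c))

  Star⊏ᶜ⇒⩽ : ∀ {c' c} → Star (_⊏_ on 𝒟ᶜ) c' c → 𝒟ᶜ c' ⩽ 𝒟ᶜ c
  Star⊏ᶜ⇒⩽ ε = ⩽-refl
  Star⊏ᶜ⇒⩽ {c'} {d} (_◅_ {j = c} c'⊏c c⊏*d) = ⩽-trans {H₂ = 𝒟ᶜ c} (proj₁ c'⊏c) (Star⊏ᶜ⇒⩽ {c} {d} c⊏*d)

  completion-⊏ᶜ? : ∀ r c → Dec (∃ λ c' → Completion r (𝒟ᶜ c') × 𝒟ᶜ c' ⊏ 𝒟ᶜ c)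
  completion-⊏ᶜ? r c = Vec-searchable anySubset? n λ c' → completion? r (𝒟ᶜ c') ×-dec (𝒟ᶜ c' ⊏? 𝒟ᶜ c)

  ⊏ᶜ-minimal⇒minimal : ∀ {r c} → (∀ z → Completion r (𝒟ᶜ z) → ¬ 𝒟ᶜ z ⊏ 𝒟ᶜ c) →
                       ∀ H → InDom r H → H ⩽ 𝒟ᶜ c → H ≐ 𝒟ᶜ c
  ⊏ᶜ-minimal⇒minimal {c = c} minimal H inDom H⩽c A with H A ≟ᵇ 𝒟ᶜ c A
  ... | yes H≡c = H≡c
  ... | no H≢c =
    let (z , H≐z) = inDom⇒≐𝒟ᶜ inDom
    in ⊥-elim (minimal z (completion-resp-≐ H≐z (proj₂ inDom))
                       (⩽-respˡ-≐ H≐z H⩽c , A , H≢c ∘ trans (H≐z A)))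

  minimalCompletion-below : ∀ {r} {H : Family n} → InDom r H →
                            ∃ λ H' → IsMinimalCompletion r H' × H' ⩽ H
  minimalCompletion-below {r} {H} inDom@((((A , A∈H) , nonempty , _) , _) , completion)
    with inDom⇒≐𝒟ᶜ inDom
  ... | c , H≐c
    with minimal-below ⊏ᶜ-wellFounded (Completion r ∘ 𝒟ᶜ) (completion-⊏ᶜ? r) c (completion-resp-≐ H≐c completion)
  ... | y , completion-y , y⊏*c , minimal =
    𝒟ᶜ y ,
    ((𝒟-isDominationHypergraph (toGraph y) (proj₁ (nonempty A A∈H)) , completion-y) ,
     ⊏ᶜ-minimal⇒minimal {r} {y} minimal) ,
    ⩽-respʳ-≐ {H₁ = 𝒟ᶜ y} {𝒟ᶜ c} {H} (≡.sym ∘ H≐c) (Star⊏ᶜ⇒⩽ y⊏*c)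

module AvoidingGraph {n : ℕ} (v : Fin n) (Y : Subset n) (v∉Y : v ∉ Y) where

  Edge : Fin n → Fin n → Set
  Edge u w = u ≢ w × ¬ (u ≡ v × w ∈ Y) × ¬ (w ≡ v × u ∈ Y)

  edge? : ∀ u w → Dec (Edge u w)
  edge? u w = ¬? (u ≟ᶠ w) ×-dec ¬? ((u ≟ᶠ v) ×-dec (w ∈? Y)) ×-dec ¬? ((w ≟ᶠ v) ×-dec (u ∈? Y))

  G : Graph n
  G = decGraph edge? (λ (u≢w , vY , Yv) → ≢-sym u≢w , Yv , vY) (λ (u≢u , _) → u≢u refl)

  adjacent : ∀ {u w} → u ≢ w → (u ≡ v → w ∉ Y) → (w ≡ v → u ∉ Y) → adj G u w ≡ true
  adjacent {u} {w} u≢w u≡v⇒w∉Y w≡v⇒u∉Y =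
    dec-true (edge? u w) (u≢w , (λ (u≡v , w∈Y) → u≡v⇒w∉Y u≡v w∈Y) , λ (w≡v , u∈Y) → w≡v⇒u∉Y w≡v u∈Y)

  Y-not-adjacent-v : ∀ {u} → u ∈ Y → adj G u v ≢ true
  Y-not-adjacent-v {u} u∈Y uv = proj₂ (proj₂ (dec-witness (edge? u v) uv)) (refl , u∈Y)

  v-not-adjacent-Y : ∀ {w} → w ∈ Y → adj G v w ≢ true
  v-not-adjacent-Y {w} w∈Y vw = proj₁ (proj₂ (dec-witness (edge? v w) vw)) (refl , w∈Y)

  Y-not-dominating : ¬ Dominating G Y
  Y-not-dominating dom = let (u , u∈Y , uv) = dom v v∉Y in Y-not-adjacent-v u∈Y uv

  blockedBy : ∀ {w} → Dec (w ≡ v) → Dec (w ∈ Y) → Subset n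
  blockedBy (yes _) _       = Y
  blockedBy (no _)  (yes _) = ⁅ v ⁆
  blockedBy (no _)  (no _)  = ⊥

  blocked : Fin n → Subset n
  blocked w = blockedBy (w ≟ᶠ v) (w ∈? Y)

  adjacent-unless-blocked : ∀ {u w} → u ≢ w → u ∉ blocked w → adj G u w ≡ true
  adjacent-unless-blocked {u} {w} u≢w = go (w ≟ᶠ v) (w ∈? Y)
    where
    go : (w≟v : Dec (w ≡ v)) (w∈?Y : Dec (w ∈ Y)) → u ∉ blockedBy w≟v w∈?Y → adj G u w ≡ true
    go (yes refl) _        u∉Y = adjacent u≢w (⊥-elim ∘ u≢w) (λ _ → u∉Y)
    go (no w≢v)   (yes _)  u∉v = adjacent u≢w (⊥-elim ∘ x∉⁅y⁆⇒x≢y u∉v) (⊥-elim ∘ w≢v)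
    go (no w≢v)   (no w∉Y) _   = adjacent u≢w (λ _ → w∉Y) (⊥-elim ∘ w≢v)

  ∣blocked∣<r : ∀ {r} → 1 ≤ r → ∣ Y ∣ < r → ∀ w → ∣ blocked w ∣ < r
  ∣blocked∣<r {r} 1≤r ∣Y∣<r w with w ≟ᶠ v | w ∈? Y
  ... | yes _ | _ = ∣Y∣<r
  ... | no _  | yes w∈Y = ≤-<-trans ∣⁅v⁆∣≤∣Y∣ ∣Y∣<r
    where
    ∣⁅v⁆∣≤∣Y∣ : ∣ ⁅ v ⁆ ∣ ≤ ∣ Y ∣
    ∣⁅v⁆∣≤∣Y∣ = subst (_≤ ∣ Y ∣) (trans (∣⁅x⁆∣≡1 w) (≡.sym (∣⁅x⁆∣≡1 v)))
                  (p⊆q⇒∣p∣≤∣q∣ λ x∈⁅w⁆ → subst (_∈ Y) (≡.sym (x∈⁅y⁆⇒x≡y w x∈⁅w⁆)) w∈Y)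
  ... | no _  | no _ = subst (_< r) (≡.sym (∣⊥∣≡0 n)) 1≤r

  U⩽𝒟 : ∀ {r} → 1 ≤ r → ∣ Y ∣ < r → U r ⩽ 𝒟 G
  U⩽𝒟 1≤r ∣Y∣<r S S∈U =
    let (M , M⊆S , minM) = minimalDominating-⊆ G (large-sets-dominate G blocked adjacent-unless-blocked
                             λ w → <-≤-trans (∣blocked∣<r 1≤r ∣Y∣<r w) (≤-reflexive (≡.sym (U-size S∈U))))
    in M , minimalDominating⇒∈𝒟 G minM , M⊆S

  v-critical : Dominating G (Y ∪ ⁅ v ⁆)
  v-critical w w∉ = v , x∈p∪q⁺ (inj₂ (x∈⁅x⁆ v)) ,
    adjacent (≢-sym (∉∪⁅y⁆⇒≢ w∉)) (λ _ → ∉∪⇒∉ˡ w∉) (λ _ → v∉Y)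

  Y-member-critical : ∀ {x} → x ≢ v → x ∈ Y → Dominating G (⁅ v ⁆ ∪ ⁅ x ⁆)
  Y-member-critical {x} x≢v x∈Y w w∉ = go (w ∈? Y)
    where
    w≢v : w ≢ v
    w≢v = x∉⁅y⁆⇒x≢y (∉∪⇒∉ˡ w∉)
    go : Dec (w ∈ Y) → ∃ λ u → u ∈ ⁅ v ⁆ ∪ ⁅ x ⁆ × adj G u w ≡ true
    go (yes _)   = x , x∈p∪q⁺ (inj₂ (x∈⁅x⁆ x)) ,
                   adjacent (≢-sym (∉∪⁅y⁆⇒≢ w∉)) (⊥-elim ∘ x≢v) (⊥-elim ∘ w≢v)
    go (no w∉Y) = v , x∈p∪q⁺ (inj₁ (x∈⁅x⁆ v)) , adjacent (≢-sym w≢v) (λ _ → w∉Y) (λ _ → v∉Y)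

  ⁅v⁆-not-dominating : ∀ {x} → x ≢ v → x ∈ Y → ¬ Dominating G ⁅ v ⁆
  ⁅v⁆-not-dominating {x} x≢v x∈Y dom with dom x (x≢v ∘ x∈⁅y⁆⇒x≡y v)
  ... | u , u∈⁅v⁆ , ux with x∈⁅y⁆⇒x≡y v u∈⁅v⁆
  ...   | refl = v-not-adjacent-Y x∈Y ux

  other-critical : ∀ {x} → x ≢ v → x ∉ Y → Dominating G (⊥ ∪ ⁅ x ⁆)
  other-critical {x} x≢v x∉Y w w∉ =
    x , x∈p∪q⁺ (inj₂ (x∈⁅x⁆ x)) , adjacent (≢-sym (∉∪⁅y⁆⇒≢ w∉)) (⊥-elim ∘ x≢v) (λ _ → x∉Y)

  hasGroundSet : HasGroundSet (𝒟 G)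
  hasGroundSet x with x ≟ᶠ v | x ∈? Y
  ... | yes refl | _      = critical⇒∈𝒟 G v-critical Y-not-dominating
  ... | no x≢v   | yes x∈Y = critical⇒∈𝒟 G (Y-member-critical x≢v x∈Y) (⁅v⁆-not-dominating x≢v x∈Y)
  ... | no x≢v   | no x∉Y = critical⇒∈𝒟 G (other-critical x≢v x∉Y) (⊥-not-dominating G x)

  ⩽𝒟⇒avoids : ∀ {H} → H ⩽ 𝒟 G → Avoids H Y
  ⩽𝒟⇒avoids H⩽𝒟 M M∈H M⊆Y =
    let (M₀ , M₀∈𝒟 , M₀⊆M) = H⩽𝒟 M M∈H
    in Y-not-dominating (dominating-mono G (proj₁ (∈𝒟⇒minimalDominating G M₀∈𝒟)) (⊆-trans M₀⊆M M⊆Y))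

minimalCompletion-avoiding : ∀ {n r} {Y : Subset n} → 1 ≤ r → r ≤ n → ∣ Y ∣ < r →
                             ∃ λ H → IsMinimalCompletion r H × Avoids H Y
minimalCompletion-avoiding {n} {r} {Y} 1≤r r≤n ∣Y∣<r =
  let (v , v∉Y) = ∣p∣<n⇒∃∉ (<-≤-trans ∣Y∣<r r≤n)
      open AvoidingGraph v Y v∉Y
      (H , minimal , H⩽𝒟) = minimalCompletion-below (𝒟-isDominationHypergraph G v , hasGroundSet , U⩽𝒟 1≤r ∣Y∣<r)
  in H , minimal , ⩽𝒟⇒avoids H⩽𝒟

module _ {n r : ℕ} (P : Family n → Set) (U⩽ : ∀ {H} → P H → U r ⩽ H)
         (avoiding : ∀ Y → ∣ Y ∣ < r → ∃ λ H → P H × Avoids H Y) where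

  unionOfChoice-large : ∀ {B} → IsUnionOfChoice P B → r ≤ ∣ B ∣
  unionOfChoice-large {B} (c , c∈ , B⇔) = ≮⇒≥ λ ∣B∣<r →
    let (H , PH , H-avoids-B) = avoiding B ∣B∣<r
    in H-avoids-B (c H PH) (c∈ H PH) λ {x} x∈c → Equivalence.from (B⇔ x) (H , PH , x∈c)

  r-set-unionOfChoice : ∀ {A} → ∣ A ∣ ≡ r → IsUnionOfChoice P A
  r-set-unionOfChoice {A} ∣A∣≡r = c , c∈ , λ x → mk⇔ (covered x) λ (H , PH , x∈c) → c⊆A H PH x∈c
    where
    below : ∀ H → P H → ∃ λ M → M ∈ᶠ H × M ⊆ A
    below H PH = U⩽ PH A (size⇒∈U ∣A∣≡r)
    c : ∀ H → P H → Subset n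
    c H PH = proj₁ (below H PH)
    c∈ : ∀ H (PH : P H) → c H PH ∈ᶠ H
    c∈ H PH = proj₁ (proj₂ (below H PH))
    c⊆A : ∀ H (PH : P H) → c H PH ⊆ A
    c⊆A H PH = proj₂ (proj₂ (below H PH))
    -- A family avoiding A - x must choose a set containing x.
    covered : ∀ x → x ∈ A → ∃ λ H → Σ (P H) λ PH → x ∈ c H PH
    covered x x∈A with avoiding (A - x) (subst (∣ A - x ∣ <_) ∣A∣≡r (x∈p⇒∣p-x∣<∣p∣ x∈A))
    ... | H , PH , H-avoids with x ∈? c H PH
    ...   | yes x∈c = H , PH , x∈c
    ...   | no x∉c = ⊥-elim (H-avoids (c H PH) (c∈ H PH) λ {y} y∈c →
                       x∈p∧x≢y⇒x∈p-y (c⊆A H PH y∈c) λ y≡x → x∉c (subst (_∈ c H PH) y≡x y∈c))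

  U⇔InMeet : ∀ A → A ∈ᶠ U r ⇔ InMeet P A
  U⇔InMeet A = mk⇔ to from
    where
    to : A ∈ᶠ U r → InMeet P A
    to A∈U = r-set-unionOfChoice (U-size A∈U) , λ B B-union B⊂A →
      <⇒≱ (subst (∣ B ∣ <_) (U-size A∈U) (p⊂q⇒∣p∣<∣q∣ B⊂A)) (unionOfChoice-large B-union)
    from : InMeet P A → A ∈ᶠ U r
    from (A-union , minimal) = size⇒∈U (≤-antisym (≮⇒≥ r≮∣A∣) (unionOfChoice-large A-union))
      where
      r≮∣A∣ : ¬ r < ∣ A ∣
      r≮∣A∣ r<∣A∣ =
        let (B , B⊆A , ∣B∣≡r) = ⊆-of-size A r (<⇒≤ r<∣A∣)
            B≢A = λ B≡A → <-irrefl (≡.sym ∣B∣≡r) (subst (λ S → r < ∣ S ∣) (≡.sym B≡A) r<∣A∣)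
        in minimal B (r-set-unionOfChoice ∣B∣≡r) (⊆∧≢⇒⊂ B⊆A B≢A)

theorem3p6 : (n r : ℕ) → 1 ≤ r → r ≤ n →
    ∀ (A : Subset n) → (A ∈ᶠ U r) ⇔ InMeet (IsMinimalCompletion {n} r) A
theorem3p6 n r 1≤r r≤n =
  U⇔InMeet (IsMinimalCompletion r) (λ minimal → proj₂ (proj₂ (proj₁ minimal)))
           (λ Y ∣Y∣<r → minimalCompletion-avoiding 1≤r r≤n ∣Y∣<r)
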